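{- Let $p\ge 7$ be a prime and $a\in\{3,\dots,p-3\}$. Then the sets $I:=\{0,1,\dots,a-1\}$ and $I':=\{0,1,\dots,a-2\}\cup\{a\}$ in $\mathbb{Z}_p$ are not affine equivalent. Consequently, no punctured interval of size $a$ is affine equivalent to an interval of size $a$.
   Context: Two subsets $A,B\subseteq\mathbb{Z}_p$ are affine equivalent if $B=\{\xi x+\eta:x\in A\}$ for some $\xi,\eta\in\mathbb{Z}_p$ with $\xi\neq0$. An interval of size $a$ is a set $\{x,x+1,\dots,x+a-1\}\subseteq\mathbb{Z}_p$. An $a$-subset $A\subseteq\mathbb{Z}_p$ is a punctured interval if $A=I'+t$ or $A=-I'+t$ for some $t\in\mathbb{Z}_p$, where $-I'+t=\{ -z+t:z\in I'\}$. -}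

module Defs where

open import Data.Nat using (ℕ; zero; suc; _+_; _*_; _∸_; _<_; NonZero)
open import Data.Nat.DivMod using (_mod_)
open import Data.Fin using (Fin; toℕ)
open import Data.Product using (Σ; ∃; _×_; _,_)
open import Relation.Binary.PropositionalEquality using (_≡_)
open import Relation.Nullary using (¬_)
open import Function.Bundles using (_⇔_)
open import Level using (0ℓ)

ℤ/ : ℕ → Set
ℤ/ p = Fin p

module _ (p : ℕ) .{{_ : NonZero p}} where

  [_] : ℕ → ℤ/ p
  [ n ] = n mod p

  _+ₚ_ : ℤ/ p → ℤ/ p → ℤ/ p
  x +ₚ y = (toℕ x + toℕ y) mod p

  _*ₚ_ : ℤ/ p → ℤ/ p → ℤ/ p
  x *ₚ y = (toℕ x * toℕ y) mod p

  -ₚ_ : ℤ/ p → ℤ/ p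
  -ₚ x = (p ∸ toℕ x) mod p

  SubsetZ : Set₁
  SubsetZ = ℤ/ p → Set

  _≐_ : SubsetZ → SubsetZ → Set
  A ≐ B = ∀ y → A y ⇔ B y

  affineImage : ℤ/ p → ℤ/ p → SubsetZ → SubsetZ
  affineImage ξ η A y = ∃ λ x → A x × (y ≡ (ξ *ₚ x) +ₚ η)

  AffineEquivalent : SubsetZ → SubsetZ → Set
  AffineEquivalent A B =
    ∃ λ ξ → ∃ λ η → ¬ (ξ ≡ [ 0 ]) × (B ≐ affineImage ξ η A)

  Interval : ℕ → ℤ/ p → SubsetZ
  Interval a x y = ∃ λ i → i < a × (y ≡ x +ₚ [ i ])

  Iset : ℕ → SubsetZ
  Iset a y = ∃ λ i → i < a × (y ≡ [ i ])

  I'set : ℕ → SubsetZ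
  I'set a y = (∃ λ i → i < a ∸ 1 × (y ≡ [ i ])) Data.Sum.⊎ (y ≡ [ a ])
    where import Data.Sum

  shift : SubsetZ → ℤ/ p → SubsetZ
  shift A t y = ∃ λ z → A z × (y ≡ z +ₚ t)

  negShift : SubsetZ → ℤ/ p → SubsetZ
  negShift A t y = ∃ λ z → A z × (y ≡ (-ₚ z) +ₚ t)

  PuncturedInterval : ℕ → SubsetZ → Set
  PuncturedInterval a A =
    ∃ λ t → (A ≐ shift (I'set a) t) Data.Sum.⊎ (A ≐ negShift (I'set a) t)
    where import Data.Sum

-- Let f x = ξ x + η with ξ ≠ 0. A point y of f(I) with y + ξ ∉ f(I) must be f(a − 1),
-- because f(i) + ξ = f(i + 1). For every ξ ≠ 0, however, I′ has two points y with
-- y + ξ ∉ I′, found by a case analysis on the representative of ξ in (0, p); so I′ is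
-- not an affine image of I. Inverses and composites of affine bijections of ℤ/p are
-- affine, so an affine equivalence between ±I′ + t and an interval x + I would yield
-- one between I and I′.

module Submission where

open import Defs
open import Data.Nat using (ℕ; _≤_; NonZero)
open import Data.Nat.Primality using (Prime)
open import Data.Product using (_×_)
open import Relation.Nullary using (¬_)

open import Data.Nat
  using (suc; zero; _+_; _*_; _∸_; _%_; _<_; _≤?_; _<?_; s≤s; z<s; compare; less; equal; greater
        ; >-nonZero⁻¹; ≢-nonZero; nonTrivial⇒n>1)
open import Data.Nat.Properties
  using (≤-refl; ≤-trans; ≤-antisym; <-irrefl; <-asym; <-trans; <-≤-trans; ≤-<-trans; <⇒≤; <⇒≢; ≮⇒≥; ≰⇒>
        ; n≤1+n; n<1+n; m<m+n; m+n≮n; m+n≤o⇒n≤o; m≤n⇒∃[o]m+o≡n; n≢0⇒n>0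
        ; m∸n≤m; m∸n+n≡m; m+[n∸m]≡n; ∸-monoʳ-<
        ; +-comm; +-assoc; +-identityʳ; *-comm; *-assoc; *-identityˡ; *-distribˡ-+)
open import Data.Nat.DivMod using (%-distribˡ-+; %-distribˡ-*; [m+kn]%n≡m%n; [m+n]%n≡m%n; m%n<n; m<n⇒m%n≡m; n%n≡0)
open import Data.Nat.GCD using (module Bézout)
open import Data.Nat.Coprimality using (coprime-Bézout; prime⇒coprime)
open import Data.Nat.Primality using (prime⇒nonTrivial)
open import Data.Nat.Tactic.RingSolver using (solve)
open import Data.Fin using (toℕ)
open import Data.Fin.Properties using (toℕ-fromℕ<; fromℕ<-cong; toℕ-injective; toℕ<n)
open import Data.Product using (Σ; ∃; ∃₂; _,_)
open import Data.Sum using (_⊎_; inj₁; inj₂)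
open import Data.List using (_∷_; [])
open import Function using (id; _∘_)
open import Function.Bundles using (mk⇔; Equivalence)
open import Function.Construct.Composition using (_⇔-∘_)
open import Function.Construct.Symmetry using (⇔-sym)
open import Relation.Nullary using (yes; no; contradiction)
open import Relation.Binary.PropositionalEquality hiding ([_])

-- Exits of I′, on representatives

InI' : ℕ → ℕ → Set
InI' a n = n < a ∸ 1 ⊎ n ≡ a

-- The complement of I′ in [0, p): the hole a − 1 and the gap above a.
OutI' : ℕ → ℕ → Set
OutI' a n = n ≡ a ∸ 1 ⊎ a < n

OutI'⇒¬InI' : ∀ {a n} → 0 < a → OutI' a n → ¬ InI' a n
OutI'⇒¬InI' _         (inj₁ refl) (inj₁ n<n)     = <-irrefl refl n<n
OutI'⇒¬InI' {suc a} _ (inj₁ refl) (inj₂ a≡1+a)   = <-irrefl a≡1+a (n<1+n a)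
OutI'⇒¬InI' {a}     _ (inj₂ a<n)  (inj₁ n<a∸1)   = <-asym a<n (<-≤-trans n<a∸1 (m∸n≤m a 1))
OutI'⇒¬InI' _         (inj₂ a<a)  (inj₂ refl)    = <-irrefl refl a<a

InI'⇒≤ : ∀ {a n} → InI' a n → n ≤ a
InI'⇒≤ {a} (inj₁ n<a∸1) = ≤-trans (<⇒≤ n<a∸1) (m∸n≤m a 1)
InI'⇒≤     (inj₂ refl)  = ≤-refl

-- An exit of I′ in direction k, computed on representatives.
record ExitRep (a p k : ℕ) : Set where
  constructor exitRep
  field
    source target : ℕ
    source∈I' : InI' a source
    target∉I' : OutI' a target
    target<p  : target < p
    source+k  : source + k ≡ target ⊎ source + k ≡ target + p

TwoExitReps : ℕ → ℕ → ℕ → Set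
TwoExitReps a p k =
  Σ (ExitRep a p k × ExitRep a p k) λ (e₁ , e₂) → ExitRep.source e₁ ≢ ExitRep.source e₂

m+[1+d]≡n⇒m<n : ∀ m n d → m + suc d ≡ n → m < n
m+[1+d]≡n⇒m<n m n d refl = m<m+n m z<s

exitToGap : ∀ {a p k} s d e → InI' a s → s + k ≡ a + suc d → a + suc d + suc e ≡ p → ExitRep a p k
exitToGap {a} s d e s∈I' s+k≡t t+1+e≡p =
  exitRep s (a + suc d) s∈I' (inj₂ (m<m+n a z<s)) (m+[1+d]≡n⇒m<n (a + suc d) _ e t+1+e≡p) (inj₁ s+k≡t)

exitToHole : ∀ {h p k} s e → InI' (suc h) s → h + suc e ≡ p → s + k ≡ h ⊎ s + k ≡ h + p →
             ExitRep (suc h) p k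
exitToHole {h} s e s∈I' h+1+e≡p s+k≡h = exitRep s h s∈I' (inj₁ refl) (m+[1+d]≡n⇒m<n h _ e h+1+e≡p) s+k≡h

-- Writing a = 3 + A and p = 6 + A + B turns every side condition into a ring identity.
I'-twoExitReps′ : ∀ A B k → 0 < k → k < 6 + A + B → 7 ≤ 6 + A + B →
               TwoExitReps (3 + A) (6 + A + B) k
I'-twoExitReps′ A B 1 _ _ _ =
  ( exitToHole (1 + A) (3 + B) (inj₁ ≤-refl) (solve (A ∷ B ∷ [])) (inj₁ (solve (A ∷ [])))
  , exitToGap (3 + A) 0 (1 + B) (inj₂ refl) (solve (A ∷ [])) (solve (A ∷ B ∷ [])) )
  , <⇒≢ (m+[1+d]≡n⇒m<n (1 + A) (3 + A) 1 (solve (A ∷ [])))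
I'-twoExitReps′ A B 2 _ _ _ =
  ( exitToHole A (3 + B) (inj₁ (n≤1+n (1 + A))) (solve (A ∷ B ∷ [])) (inj₁ (solve (A ∷ [])))
  , exitToGap (3 + A) 1 B (inj₂ refl) (solve (A ∷ [])) (solve (A ∷ B ∷ [])) )
  , <⇒≢ (m+[1+d]≡n⇒m<n A (3 + A) 2 (solve (A ∷ [])))
I'-twoExitReps′ A B (suc (suc (suc j))) _ _ _ with compare j B
... | less .j s =
  ( exitToGap (1 + A) j (2 + s) (inj₁ ≤-refl) (solve (A ∷ j ∷ [])) (solve (A ∷ j ∷ s ∷ []))
  , exitToGap (3 + A) (2 + j) s (inj₂ refl) (solve (A ∷ j ∷ [])) (solve (A ∷ j ∷ s ∷ [])) )
  , <⇒≢ (m+[1+d]≡n⇒m<n (1 + A) (3 + A) 1 (solve (A ∷ [])))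
-- a = 3, p = 6, k = 3 is the one configuration in which I′ has a single exit.
I'-twoExitReps′ zero    zero (suc (suc (suc .0))) _ _ (s≤s (s≤s (s≤s (s≤s (s≤s (s≤s ())))))) | equal .0
I'-twoExitReps′ (suc A) zero (suc (suc (suc .0))) _ _ _ | equal .0 =
  ( exitToGap (2 + A) 0 1 (inj₁ ≤-refl) (solve (A ∷ [])) (solve (A ∷ []))
  , exitToHole A 3 (inj₁ (m+[1+d]≡n⇒m<n A (3 + A) 2 (solve (A ∷ [])))) (solve (A ∷ []))
      (inj₁ (solve (A ∷ []))) )
  , <⇒≢ (m+[1+d]≡n⇒m<n A (2 + A) 1 (solve (A ∷ []))) ∘ sym
I'-twoExitReps′ A (suc B) (suc (suc (suc .(suc B)))) _ _ _ | equal .(suc B) =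
  ( exitToGap (1 + A) (1 + B) 1 (inj₁ ≤-refl) (solve (A ∷ B ∷ [])) (solve (A ∷ B ∷ []))
  , exitToGap A B 2 (inj₁ (n≤1+n (1 + A))) (solve (A ∷ B ∷ [])) (solve (A ∷ B ∷ [])) )
  , <⇒≢ (n<1+n A) ∘ sym
I'-twoExitReps′ A B (suc (suc (suc .(suc (B + j₀))))) _ k<p _ | greater .B j₀ with j₀ ≤? A
... | yes j₀≤A with m≤n⇒∃[o]m+o≡n j₀≤A
...   | t , refl =
  ( exitToGap t B 1 (inj₁ (m+[1+d]≡n⇒m<n t (2 + (j₀ + t)) (1 + j₀) (solve (j₀ ∷ t ∷ []))))
      (solve (j₀ ∷ t ∷ B ∷ [])) (solve (j₀ ∷ t ∷ B ∷ []))
  , exitToGap (1 + t) (1 + B) 0 (inj₁ (m+[1+d]≡n⇒m<n (1 + t) (2 + (j₀ + t)) j₀ (solve (j₀ ∷ t ∷ []))))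
      (solve (j₀ ∷ t ∷ B ∷ [])) (solve (j₀ ∷ t ∷ B ∷ [])) )
  , <⇒≢ (n<1+n t)
I'-twoExitReps′ A B (suc (suc (suc .(suc (B + j₀))))) _ k<p _ | greater .B j₀ | no j₀≰A
  with m≤n⇒∃[o]m+o≡n (≰⇒> j₀≰A)
... | zero , refl =
  ( exitToGap 0 (1 + B) 0 (inj₁ z<s) (solve (A ∷ B ∷ [])) (solve (A ∷ B ∷ []))
  , exitToHole (3 + A) (3 + B) (inj₂ refl) (solve (A ∷ B ∷ [])) (inj₂ (solve (A ∷ B ∷ []))) )
  , λ ()
... | suc w , refl = contradiction (subst (_< 6 + A + B) k≡w+p k<p) (m+n≮n w (6 + A + B))
  where
  k≡w+p : 3 + suc (B + (suc A + suc w)) ≡ w + (6 + A + B)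
  k≡w+p = solve (A ∷ B ∷ w ∷ [])

I'-twoExitReps : ∀ {a p k} → 3 ≤ a → a ≤ p ∸ 3 → 7 ≤ p → 0 < k → k < p → TwoExitReps a p k
I'-twoExitReps {k = k} 3≤a a≤p∸3 7≤p 0<k k<p with m≤n⇒∃[o]m+o≡n 3≤a
... | A , refl with m≤n⇒∃[o]m+o≡n a≤p∸3
...   | B , a+B≡p∸3
  with trans (+-comm 3 (3 + A + B)) (trans (cong (_+ 3) a+B≡p∸3) (m∸n+n≡m (m+n≤o⇒n≤o 4 7≤p)))
...     | refl = I'-twoExitReps′ A B k 0<k k<p 7≤p

module Residues (p : ℕ) .{{_ : NonZero p}} where

  infixl 6 _⊕_
  infixl 7 _⊗_
  infix  8 ⊝_

  _⊕_ _⊗_ : ℤ/ p → ℤ/ p → ℤ/ p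
  _⊕_ = _+ₚ_ p
  _⊗_ = _*ₚ_ p

  ⊝_ : ℤ/ p → ℤ/ p
  ⊝_ = -ₚ_ p

  ⟦_⟧ : ℕ → ℤ/ p
  ⟦_⟧ = [_] p

  open ≡-Reasoning

  toℕ-⟦⟧ : ∀ m → toℕ ⟦ m ⟧ ≡ m % p
  toℕ-⟦⟧ m = toℕ-fromℕ< (m%n<n m p)

  toℕ-⟦⟧-< : ∀ {m} → m < p → toℕ ⟦ m ⟧ ≡ m
  toℕ-⟦⟧-< {m} m<p = trans (toℕ-⟦⟧ m) (m<n⇒m%n≡m m<p)

  ⟦⟧-cong : ∀ {m n} → m % p ≡ n % p → ⟦ m ⟧ ≡ ⟦ n ⟧
  ⟦⟧-cong {m} {n} eq = fromℕ<-cong (m % p) (n % p) eq (m%n<n m p) (m%n<n n p)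

  ⟦⟧-injective : ∀ {m n} → m < p → n < p → ⟦ m ⟧ ≡ ⟦ n ⟧ → m ≡ n
  ⟦⟧-injective m<p n<p eq = trans (sym (toℕ-⟦⟧-< m<p)) (trans (cong toℕ eq) (toℕ-⟦⟧-< n<p))

  ⟦toℕ⟧ : ∀ x → ⟦ toℕ x ⟧ ≡ x
  ⟦toℕ⟧ x = toℕ-injective (toℕ-⟦⟧-< (toℕ<n x))

  ⟦⟧-elim : {P : ℤ/ p → Set} → (∀ m → P ⟦ m ⟧) → ∀ x → P x
  ⟦⟧-elim {P} h x = subst P (⟦toℕ⟧ x) (h (toℕ x))

  ⟦m+kp⟧ : ∀ m k → ⟦ m + k * p ⟧ ≡ ⟦ m ⟧
  ⟦m+kp⟧ m k = ⟦⟧-cong ([m+kn]%n≡m%n m k p)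

  ⟦p⟧ : ⟦ p ⟧ ≡ ⟦ 0 ⟧
  ⟦p⟧ = ⟦⟧-cong (trans (n%n≡0 p) (sym (m<n⇒m%n≡m (>-nonZero⁻¹ p))))

  -- ⟦_⟧ is a semiring homomorphism onto ℤ/p; with ⟦⟧-elim it transports the laws of ℕ.
  ⟦+⟧ : ∀ m n → ⟦ m + n ⟧ ≡ ⟦ m ⟧ ⊕ ⟦ n ⟧
  ⟦+⟧ m n = ⟦⟧-cong (trans (%-distribˡ-+ m n p)
    (sym (cong₂ (λ u v → (u + v) % p) (toℕ-⟦⟧ m) (toℕ-⟦⟧ n))))

  ⟦*⟧ : ∀ m n → ⟦ m * n ⟧ ≡ ⟦ m ⟧ ⊗ ⟦ n ⟧
  ⟦*⟧ m n = ⟦⟧-cong (trans (%-distribˡ-* m n p)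
    (sym (cong₂ (λ u v → (u * v) % p) (toℕ-⟦⟧ m) (toℕ-⟦⟧ n))))

  ⊕-comm : ∀ x y → x ⊕ y ≡ y ⊕ x
  ⊕-comm x y = cong ⟦_⟧ (+-comm (toℕ x) (toℕ y))

  ⊗-comm : ∀ x y → x ⊗ y ≡ y ⊗ x
  ⊗-comm x y = cong ⟦_⟧ (*-comm (toℕ x) (toℕ y))

  ⊕-assoc : ∀ x y z → x ⊕ y ⊕ z ≡ x ⊕ (y ⊕ z)
  ⊕-assoc = ⟦⟧-elim λ a → ⟦⟧-elim λ b → ⟦⟧-elim λ c → begin
    ⟦ a ⟧ ⊕ ⟦ b ⟧ ⊕ ⟦ c ⟧    ≡⟨ cong (_⊕ ⟦ c ⟧) (⟦+⟧ a b) ⟨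
    ⟦ a + b ⟧ ⊕ ⟦ c ⟧        ≡⟨ ⟦+⟧ (a + b) c ⟨
    ⟦ a + b + c ⟧            ≡⟨ cong ⟦_⟧ (+-assoc a b c) ⟩
    ⟦ a + (b + c) ⟧          ≡⟨ ⟦+⟧ a (b + c) ⟩
    ⟦ a ⟧ ⊕ ⟦ b + c ⟧        ≡⟨ cong (⟦ a ⟧ ⊕_) (⟦+⟧ b c) ⟩
    ⟦ a ⟧ ⊕ (⟦ b ⟧ ⊕ ⟦ c ⟧)  ∎

  ⊗-assoc : ∀ x y z → x ⊗ y ⊗ z ≡ x ⊗ (y ⊗ z)
  ⊗-assoc = ⟦⟧-elim λ a → ⟦⟧-elim λ b → ⟦⟧-elim λ c → begin
    ⟦ a ⟧ ⊗ ⟦ b ⟧ ⊗ ⟦ c ⟧    ≡⟨ cong (_⊗ ⟦ c ⟧) (⟦*⟧ a b) ⟨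
    ⟦ a * b ⟧ ⊗ ⟦ c ⟧        ≡⟨ ⟦*⟧ (a * b) c ⟨
    ⟦ a * b * c ⟧            ≡⟨ cong ⟦_⟧ (*-assoc a b c) ⟩
    ⟦ a * (b * c) ⟧          ≡⟨ ⟦*⟧ a (b * c) ⟩
    ⟦ a ⟧ ⊗ ⟦ b * c ⟧        ≡⟨ cong (⟦ a ⟧ ⊗_) (⟦*⟧ b c) ⟩
    ⟦ a ⟧ ⊗ (⟦ b ⟧ ⊗ ⟦ c ⟧)  ∎

  ⊗-distribˡ-⊕ : ∀ x y z → x ⊗ (y ⊕ z) ≡ x ⊗ y ⊕ x ⊗ z
  ⊗-distribˡ-⊕ = ⟦⟧-elim λ a → ⟦⟧-elim λ b → ⟦⟧-elim λ c → begin
    ⟦ a ⟧ ⊗ (⟦ b ⟧ ⊕ ⟦ c ⟧)        ≡⟨ cong (⟦ a ⟧ ⊗_) (⟦+⟧ b c) ⟨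
    ⟦ a ⟧ ⊗ ⟦ b + c ⟧              ≡⟨ ⟦*⟧ a (b + c) ⟨
    ⟦ a * (b + c) ⟧                ≡⟨ cong ⟦_⟧ (*-distribˡ-+ a b c) ⟩
    ⟦ a * b + a * c ⟧              ≡⟨ ⟦+⟧ (a * b) (a * c) ⟩
    ⟦ a * b ⟧ ⊕ ⟦ a * c ⟧          ≡⟨ cong₂ _⊕_ (⟦*⟧ a b) (⟦*⟧ a c) ⟩
    ⟦ a ⟧ ⊗ ⟦ b ⟧ ⊕ ⟦ a ⟧ ⊗ ⟦ c ⟧  ∎

  ⊕-identityʳ : ∀ x → x ⊕ ⟦ 0 ⟧ ≡ x
  ⊕-identityʳ = ⟦⟧-elim λ a → trans (sym (⟦+⟧ a 0)) (cong ⟦_⟧ (+-identityʳ a))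

  ⊗-identityˡ : ∀ x → ⟦ 1 ⟧ ⊗ x ≡ x
  ⊗-identityˡ = ⟦⟧-elim λ a → trans (sym (⟦*⟧ 1 a)) (cong ⟦_⟧ (*-identityˡ a))

  ⊗-zeroˡ : ∀ x → ⟦ 0 ⟧ ⊗ x ≡ ⟦ 0 ⟧
  ⊗-zeroˡ = ⟦⟧-elim λ a → sym (⟦*⟧ 0 a)

  ⊕-inverseʳ : ∀ x → x ⊕ ⊝ x ≡ ⟦ 0 ⟧
  ⊕-inverseʳ x = begin
    x ⊕ ⊝ x                          ≡⟨ cong (_⊕ ⊝ x) (⟦toℕ⟧ x) ⟨
    ⟦ toℕ x ⟧ ⊕ ⟦ p ∸ toℕ x ⟧        ≡⟨ ⟦+⟧ (toℕ x) (p ∸ toℕ x) ⟨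
    ⟦ toℕ x + (p ∸ toℕ x) ⟧          ≡⟨ cong ⟦_⟧ (m+[n∸m]≡n (<⇒≤ (toℕ<n x))) ⟩
    ⟦ p ⟧                            ≡⟨ ⟦p⟧ ⟩
    ⟦ 0 ⟧                            ∎

  ⊗-distribʳ-⊕ : ∀ x y z → (y ⊕ z) ⊗ x ≡ y ⊗ x ⊕ z ⊗ x
  ⊗-distribʳ-⊕ x y z = begin
    (y ⊕ z) ⊗ x      ≡⟨ ⊗-comm (y ⊕ z) x ⟩
    x ⊗ (y ⊕ z)      ≡⟨ ⊗-distribˡ-⊕ x y z ⟩
    x ⊗ y ⊕ x ⊗ z    ≡⟨ cong₂ _⊕_ (⊗-comm x y) (⊗-comm x z) ⟩
    y ⊗ x ⊕ z ⊗ x    ∎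

  ⊝-unique : ∀ {x y} → x ⊕ y ≡ ⟦ 0 ⟧ → y ≡ ⊝ x
  ⊝-unique {x} {y} x+y≡0 = begin
    y                 ≡⟨ ⊕-identityʳ y ⟨
    y ⊕ ⟦ 0 ⟧         ≡⟨ cong (y ⊕_) (⊕-inverseʳ x) ⟨
    y ⊕ (x ⊕ ⊝ x)     ≡⟨ ⊕-assoc y x (⊝ x) ⟨
    y ⊕ x ⊕ ⊝ x       ≡⟨ cong (_⊕ ⊝ x) (trans (⊕-comm y x) x+y≡0) ⟩
    ⟦ 0 ⟧ ⊕ ⊝ x       ≡⟨ ⊕-comm ⟦ 0 ⟧ (⊝ x) ⟩
    ⊝ x ⊕ ⟦ 0 ⟧       ≡⟨ ⊕-identityʳ (⊝ x) ⟩
    ⊝ x               ∎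

  ⊝-involutive : ∀ x → ⊝ ⊝ x ≡ x
  ⊝-involutive x = sym (⊝-unique (trans (⊕-comm (⊝ x) x) (⊕-inverseʳ x)))

  ⊝⟦1⟧-⊗ : ∀ x → ⊝ ⟦ 1 ⟧ ⊗ x ≡ ⊝ x
  ⊝⟦1⟧-⊗ x = ⊝-unique (begin
    x ⊕ ⊝ ⟦ 1 ⟧ ⊗ x              ≡⟨ cong (_⊕ ⊝ ⟦ 1 ⟧ ⊗ x) (⊗-identityˡ x) ⟨
    ⟦ 1 ⟧ ⊗ x ⊕ ⊝ ⟦ 1 ⟧ ⊗ x      ≡⟨ ⊗-distribʳ-⊕ x ⟦ 1 ⟧ (⊝ ⟦ 1 ⟧) ⟨
    (⟦ 1 ⟧ ⊕ ⊝ ⟦ 1 ⟧) ⊗ x        ≡⟨ cong (_⊗ x) (⊕-inverseʳ ⟦ 1 ⟧) ⟩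
    ⟦ 0 ⟧ ⊗ x                    ≡⟨ ⊗-zeroˡ x ⟩
    ⟦ 0 ⟧                        ∎)

  toℕ-≢0 : ∀ {x} → x ≢ ⟦ 0 ⟧ → toℕ x ≢ 0
  toℕ-≢0 {x} x≢0 toℕx≡0 = x≢0 (trans (sym (⟦toℕ⟧ x)) (cong ⟦_⟧ toℕx≡0))

  ⟦1⟧≢⟦0⟧ : 1 < p → ⟦ 1 ⟧ ≢ ⟦ 0 ⟧
  ⟦1⟧≢⟦0⟧ 1<p = (λ ()) ∘ ⟦⟧-injective 1<p (<-trans z<s 1<p)

  ⊝-≢0 : ∀ {x} → x ≢ ⟦ 0 ⟧ → ⊝ x ≢ ⟦ 0 ⟧
  ⊝-≢0 {x} x≢0 ⊝x≡0 = x≢0 (begin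
    x              ≡⟨ ⊕-identityʳ x ⟨
    x ⊕ ⟦ 0 ⟧      ≡⟨ cong (x ⊕_) ⊝x≡0 ⟨
    x ⊕ ⊝ x        ≡⟨ ⊕-inverseʳ x ⟩
    ⟦ 0 ⟧          ∎)

  affine : ℤ/ p → ℤ/ p → ℤ/ p → ℤ/ p
  affine ξ η x = ξ ⊗ x ⊕ η

  affine-∘ : ∀ ξ η ξ′ η′ x → affine ξ′ η′ (affine ξ η x) ≡ affine (ξ′ ⊗ ξ) (ξ′ ⊗ η ⊕ η′) x
  affine-∘ ξ η ξ′ η′ x = begin
    ξ′ ⊗ (ξ ⊗ x ⊕ η) ⊕ η′              ≡⟨ cong (_⊕ η′) (⊗-distribˡ-⊕ ξ′ (ξ ⊗ x) η) ⟩
    ξ′ ⊗ (ξ ⊗ x) ⊕ ξ′ ⊗ η ⊕ η′         ≡⟨ cong (λ u → u ⊕ ξ′ ⊗ η ⊕ η′) (⊗-assoc ξ′ ξ x) ⟨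
    ξ′ ⊗ ξ ⊗ x ⊕ ξ′ ⊗ η ⊕ η′           ≡⟨ ⊕-assoc (ξ′ ⊗ ξ ⊗ x) (ξ′ ⊗ η) η′ ⟩
    ξ′ ⊗ ξ ⊗ x ⊕ (ξ′ ⊗ η ⊕ η′)         ∎

  affine-inverse : ∀ ξ ξ′ η x → ξ′ ⊗ ξ ≡ ⟦ 1 ⟧ → affine ξ′ (⊝ (ξ′ ⊗ η)) (affine ξ η x) ≡ x
  affine-inverse ξ ξ′ η x ξ′ξ≡1 = begin
    affine ξ′ (⊝ (ξ′ ⊗ η)) (affine ξ η x)     ≡⟨ affine-∘ ξ η ξ′ (⊝ (ξ′ ⊗ η)) x ⟩
    ξ′ ⊗ ξ ⊗ x ⊕ (ξ′ ⊗ η ⊕ ⊝ (ξ′ ⊗ η))        ≡⟨ cong₂ (λ u v → u ⊗ x ⊕ v) ξ′ξ≡1 (⊕-inverseʳ (ξ′ ⊗ η)) ⟩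
    ⟦ 1 ⟧ ⊗ x ⊕ ⟦ 0 ⟧                         ≡⟨ ⊕-identityʳ (⟦ 1 ⟧ ⊗ x) ⟩
    ⟦ 1 ⟧ ⊗ x                                 ≡⟨ ⊗-identityˡ x ⟩
    x                                         ∎

  affine-step : ∀ ξ η i → affine ξ η ⟦ i ⟧ ⊕ ξ ≡ affine ξ η ⟦ suc i ⟧
  affine-step ξ η i = begin
    ξ ⊗ ⟦ i ⟧ ⊕ η ⊕ ξ            ≡⟨ ⊕-assoc (ξ ⊗ ⟦ i ⟧) η ξ ⟩
    ξ ⊗ ⟦ i ⟧ ⊕ (η ⊕ ξ)          ≡⟨ cong (ξ ⊗ ⟦ i ⟧ ⊕_) (⊕-comm η ξ) ⟩
    ξ ⊗ ⟦ i ⟧ ⊕ (ξ ⊕ η)          ≡⟨ ⊕-assoc (ξ ⊗ ⟦ i ⟧) ξ η ⟨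
    ξ ⊗ ⟦ i ⟧ ⊕ ξ ⊕ η            ≡⟨ cong (λ u → ξ ⊗ ⟦ i ⟧ ⊕ u ⊕ η) (trans (⊗-comm ξ ⟦ 1 ⟧) (⊗-identityˡ ξ)) ⟨
    ξ ⊗ ⟦ i ⟧ ⊕ ξ ⊗ ⟦ 1 ⟧ ⊕ η    ≡⟨ cong (_⊕ η) (⊗-distribˡ-⊕ ξ ⟦ i ⟧ ⟦ 1 ⟧) ⟨
    ξ ⊗ (⟦ i ⟧ ⊕ ⟦ 1 ⟧) ⊕ η      ≡⟨ cong (λ u → ξ ⊗ u ⊕ η) (⟦+⟧ i 1) ⟨
    ξ ⊗ ⟦ i + 1 ⟧ ⊕ η            ≡⟨ cong (λ j → ξ ⊗ ⟦ j ⟧ ⊕ η) (+-comm i 1) ⟩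
    ξ ⊗ ⟦ suc i ⟧ ⊕ η            ∎

  infix 4 _≐ₚ_
  _≐ₚ_ : SubsetZ p → SubsetZ p → Set
  _≐ₚ_ = _≐_ p

  ≐-sym : ∀ {A B} → A ≐ₚ B → B ≐ₚ A
  ≐-sym A≐B y = ⇔-sym (A≐B y)

  ≐-trans : ∀ {A B C} → A ≐ₚ B → B ≐ₚ C → A ≐ₚ C
  ≐-trans A≐B B≐C y = B≐C y ⇔-∘ A≐B y

  -- affineImage ξ η, shift and negShift are definitionally images of maps.
  Image : (ℤ/ p → ℤ/ p) → SubsetZ p → SubsetZ p
  Image f A y = ∃ λ x → A x × y ≡ f x

  Image-cong : ∀ {f g A} → (∀ x → f x ≡ g x) → Image f A ≐ₚ Image g A
  Image-cong f≗g _ = mk⇔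
    (λ (x , Ax , y≡fx) → x , Ax , trans y≡fx (f≗g x))
    (λ (x , Ax , y≡gx) → x , Ax , trans y≡gx (sym (f≗g x)))

  Image-resp-≐ : ∀ {f A B} → A ≐ₚ B → Image f A ≐ₚ Image f B
  Image-resp-≐ A≐B _ = mk⇔
    (λ (x , Ax , eq) → x , Equivalence.to (A≐B x) Ax , eq)
    (λ (x , Bx , eq) → x , Equivalence.from (A≐B x) Bx , eq)

  Image-∘ : ∀ {f g A} → Image g (Image f A) ≐ₚ Image (g ∘ f) A
  Image-∘ {f} _ = mk⇔
    (λ { (_ , (x , Ax , refl) , eq) → x , Ax , eq })
    (λ (x , Ax , eq) → f x , (x , Ax , refl) , eq)

  Image-id : ∀ {A} → Image id A ≐ₚ A
  Image-id y = mk⇔ (λ { (x , Ax , refl) → Ax }) (λ Ay → y , Ay , refl)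

  shift-affine : ∀ A t → shift p A t ≐ₚ affineImage p ⟦ 1 ⟧ t A
  shift-affine A t = Image-cong λ z → cong (_⊕ t) (sym (⊗-identityˡ z))

  negShift-affine : ∀ A t → negShift p A t ≐ₚ affineImage p (⊝ ⟦ 1 ⟧) t A
  negShift-affine A t = Image-cong λ z → cong (_⊕ t) (sym (⊝⟦1⟧-⊗ z))

  Interval-affine : ∀ a x → Interval p a x ≐ₚ affineImage p ⟦ 1 ⟧ x (Iset p a)
  Interval-affine a x _ = mk⇔
    (λ (i , i<a , y≡x+i) → ⟦ i ⟧ , (i , i<a , refl) , trans y≡x+i (x⊕z≡1z⊕x ⟦ i ⟧))
    (λ { (_ , (i , i<a , refl) , eq) → i , i<a , trans eq (sym (x⊕z≡1z⊕x ⟦ i ⟧)) })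
    where
    x⊕z≡1z⊕x : ∀ z → x ⊕ z ≡ ⟦ 1 ⟧ ⊗ z ⊕ x
    x⊕z≡1z⊕x z = trans (⊕-comm x z) (cong (_⊕ x) (sym (⊗-identityˡ z)))

  Iset≃Interval : 1 < p → ∀ a x → AffineEquivalent p (Iset p a) (Interval p a x)
  Iset≃Interval 1<p a x = ⟦ 1 ⟧ , x , ⟦1⟧≢⟦0⟧ 1<p , Interval-affine a x

  punctured⇒≃ : 1 < p → ∀ {a A} → PuncturedInterval p a A → AffineEquivalent p (I'set p a) A
  punctured⇒≃ 1<p {a} (t , inj₁ A≐I'+t) =
    ⟦ 1 ⟧ , t , ⟦1⟧≢⟦0⟧ 1<p , ≐-trans A≐I'+t (shift-affine (I'set p a) t)
  punctured⇒≃ 1<p {a} (t , inj₂ A≐-I'+t) =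
    ⊝ ⟦ 1 ⟧ , t , ⊝-≢0 (⟦1⟧≢⟦0⟧ 1<p) , ≐-trans A≐-I'+t (negShift-affine (I'set p a) t)

  Exit : SubsetZ p → ℤ/ p → ℤ/ p → Set
  Exit A ξ y = A y × ¬ A (y ⊕ ξ)

  affine-interval-exit : ∀ {a ξ η B y} → B ≐ₚ affineImage p ξ η (Iset p a) →
                         Exit B ξ y → y ≡ affine ξ η ⟦ a ∸ 1 ⟧
  affine-interval-exit {a} {ξ} {η} B≐ξI+η (y∈B , y+ξ∉B) with Equivalence.to (B≐ξI+η _) y∈B
  ... | _ , (i , i<a , refl) , refl with suc i <? a
  ...   | yes 1+i<a = contradiction
          (Equivalence.from (B≐ξI+η _) (⟦ suc i ⟧ , (suc i , 1+i<a , refl) , affine-step ξ η i))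
          y+ξ∉B
  ...   | no 1+i≮a = cong (λ j → affine ξ η ⟦ j ∸ 1 ⟧) (≤-antisym i<a (≮⇒≥ 1+i≮a))

  InI'⇒I'set : ∀ {a n} → InI' a n → I'set p a ⟦ n ⟧
  InI'⇒I'set (inj₁ n<a∸1) = inj₁ (_ , n<a∸1 , refl)
  InI'⇒I'set (inj₂ refl)  = inj₂ refl

  I'set⇒InI' : ∀ {a y} → a < p → I'set p a y → InI' a (toℕ y)
  I'set⇒InI' {a} a<p (inj₁ (j , j<a∸1 , refl)) =
    inj₁ (subst (_< a ∸ 1) (sym (toℕ-⟦⟧-< (<-≤-trans j<a∸1 (≤-trans (m∸n≤m a 1) (<⇒≤ a<p))))) j<a∸1)
  I'set⇒InI' a<p (inj₂ refl) = inj₂ (toℕ-⟦⟧-< a<p)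

  ⟦⟧-⊕-wrap : ∀ {n t} ξ → n + toℕ ξ ≡ t ⊎ n + toℕ ξ ≡ t + p → ⟦ n ⟧ ⊕ ξ ≡ ⟦ t ⟧
  ⟦⟧-⊕-wrap {n} {t} ξ n+k≡t = begin
    ⟦ n ⟧ ⊕ ξ             ≡⟨ cong (⟦ n ⟧ ⊕_) (⟦toℕ⟧ ξ) ⟨
    ⟦ n ⟧ ⊕ ⟦ toℕ ξ ⟧     ≡⟨ ⟦+⟧ n (toℕ ξ) ⟨
    ⟦ n + toℕ ξ ⟧         ≡⟨ ⟦n+k⟧≡⟦t⟧ n+k≡t ⟩
    ⟦ t ⟧                 ∎
    where
    ⟦n+k⟧≡⟦t⟧ : n + toℕ ξ ≡ t ⊎ n + toℕ ξ ≡ t + p → ⟦ n + toℕ ξ ⟧ ≡ ⟦ t ⟧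
    ⟦n+k⟧≡⟦t⟧ (inj₁ eq) = cong ⟦_⟧ eq
    ⟦n+k⟧≡⟦t⟧ (inj₂ eq) = trans (cong ⟦_⟧ eq) (⟦⟧-cong ([m+n]%n≡m%n t p))

  ExitRep⇒Exit : ∀ {a ξ} → 0 < a → a < p → (e : ExitRep a p (toℕ ξ)) →
                 Exit (I'set p a) ξ ⟦ ExitRep.source e ⟧
  ExitRep⇒Exit {a} {ξ} 0<a a<p (exitRep n t n∈I' t∉I' t<p n+k≡t) =
    InI'⇒I'set n∈I' , λ n+ξ∈I' → OutI'⇒¬InI' 0<a t∉I'
      (subst (InI' a) (toℕ-⟦⟧-< t<p) (I'set⇒InI' a<p (subst (I'set p a) (⟦⟧-⊕-wrap ξ n+k≡t) n+ξ∈I')))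

  I'-twoExits : ∀ {a ξ} → 3 ≤ a → a ≤ p ∸ 3 → 7 ≤ p → ξ ≢ ⟦ 0 ⟧ →
                ∃₂ λ y₁ y₂ → y₁ ≢ y₂ × Exit (I'set p a) ξ y₁ × Exit (I'set p a) ξ y₂
  I'-twoExits {a} {ξ} 3≤a a≤p∸3 7≤p ξ≢0
    with I'-twoExitReps 3≤a a≤p∸3 7≤p (n≢0⇒n>0 (toℕ-≢0 ξ≢0)) (toℕ<n ξ)
  ... | (e₁ , e₂) , source₁≢source₂ =
    ⟦ source e₁ ⟧ , ⟦ source e₂ ⟧ ,
    source₁≢source₂ ∘ ⟦⟧-injective (source<p e₁) (source<p e₂) ,
    ExitRep⇒Exit 0<a a<p e₁ , ExitRep⇒Exit 0<a a<p e₂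
    where
    open ExitRep using (source; source∈I')
    0<a : 0 < a
    0<a = <-≤-trans z<s 3≤a
    a<p : a < p
    a<p = ≤-<-trans a≤p∸3 (∸-monoʳ-< z<s (m+n≤o⇒n≤o 4 7≤p))
    source<p : (e : ExitRep a p (toℕ ξ)) → source e < p
    source<p e = ≤-<-trans (InI'⇒≤ (source∈I' e)) a<p

  Iset≁I'set : ∀ {a} → 3 ≤ a → a ≤ p ∸ 3 → 7 ≤ p → ¬ AffineEquivalent p (Iset p a) (I'set p a)
  Iset≁I'set 3≤a a≤p∸3 7≤p (ξ , η , ξ≢0 , I'≐ξI+η) with I'-twoExits 3≤a a≤p∸3 7≤p ξ≢0
  ... | y₁ , y₂ , y₁≢y₂ , exit₁ , exit₂ =
    y₁≢y₂ (trans (affine-interval-exit I'≐ξI+η exit₁) (sym (affine-interval-exit I'≐ξI+η exit₂)))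

  module Field (p-prime : Prime p) where

    1<p : 1 < p
    1<p = nonTrivial⇒n>1 p {{prime⇒nonTrivial p-prime}}

    -- Bézout gives v · toℕ x ≡ ±1 (mod p).
    ⊗-inverse : ∀ x → x ≢ ⟦ 0 ⟧ → ∃ λ y → y ⊗ x ≡ ⟦ 1 ⟧
    ⊗-inverse x x≢0
      with coprime-Bézout (prime⇒coprime p-prime {{≢-nonZero (toℕ-≢0 x≢0)}} (toℕ<n x))
    ... | Bézout.-+ u v 1+up≡vn = ⟦ v ⟧ , (begin
      ⟦ v ⟧ ⊗ x          ≡⟨ cong (⟦ v ⟧ ⊗_) (⟦toℕ⟧ x) ⟨
      ⟦ v ⟧ ⊗ ⟦ n ⟧      ≡⟨ ⟦*⟧ v n ⟨
      ⟦ v * n ⟧          ≡⟨ cong ⟦_⟧ 1+up≡vn ⟨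
      ⟦ 1 + u * p ⟧      ≡⟨ ⟦m+kp⟧ 1 u ⟩
      ⟦ 1 ⟧              ∎)
      where
      n : ℕ
      n = toℕ x
    ... | Bézout.+- u v 1+vn≡up = ⊝ ⟦ 1 ⟧ ⊗ ⟦ v ⟧ , (begin
      ⊝ ⟦ 1 ⟧ ⊗ ⟦ v ⟧ ⊗ x      ≡⟨ ⊗-assoc (⊝ ⟦ 1 ⟧) ⟦ v ⟧ x ⟩
      ⊝ ⟦ 1 ⟧ ⊗ (⟦ v ⟧ ⊗ x)    ≡⟨ cong (⊝ ⟦ 1 ⟧ ⊗_) vx≡⊝1 ⟩
      ⊝ ⟦ 1 ⟧ ⊗ ⊝ ⟦ 1 ⟧        ≡⟨ ⊝⟦1⟧-⊗ (⊝ ⟦ 1 ⟧) ⟩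
      ⊝ ⊝ ⟦ 1 ⟧                ≡⟨ ⊝-involutive ⟦ 1 ⟧ ⟩
      ⟦ 1 ⟧                    ∎)
      where
      n : ℕ
      n = toℕ x
      vx≡⊝1 : ⟦ v ⟧ ⊗ x ≡ ⊝ ⟦ 1 ⟧
      vx≡⊝1 = ⊝-unique (begin
        ⟦ 1 ⟧ ⊕ ⟦ v ⟧ ⊗ x        ≡⟨ cong (λ z → ⟦ 1 ⟧ ⊕ ⟦ v ⟧ ⊗ z) (⟦toℕ⟧ x) ⟨
        ⟦ 1 ⟧ ⊕ ⟦ v ⟧ ⊗ ⟦ n ⟧    ≡⟨ cong (⟦ 1 ⟧ ⊕_) (⟦*⟧ v n) ⟨
        ⟦ 1 ⟧ ⊕ ⟦ v * n ⟧        ≡⟨ ⟦+⟧ 1 (v * n) ⟨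
        ⟦ 1 + v * n ⟧            ≡⟨ cong ⟦_⟧ 1+vn≡up ⟩
        ⟦ u * p ⟧                ≡⟨ ⟦m+kp⟧ 0 u ⟩
        ⟦ 0 ⟧                    ∎)

    ⊗-≢0 : ∀ {x y} → x ≢ ⟦ 0 ⟧ → y ≢ ⟦ 0 ⟧ → y ⊗ x ≢ ⟦ 0 ⟧
    ⊗-≢0 {x} {y} x≢0 y≢0 yx≡0 with ⊗-inverse x x≢0
    ... | x⁻¹ , x⁻¹x≡1 = y≢0 (begin
      y                   ≡⟨ ⊗-identityˡ y ⟨
      ⟦ 1 ⟧ ⊗ y           ≡⟨ cong (_⊗ y) x⁻¹x≡1 ⟨
      x⁻¹ ⊗ x ⊗ y         ≡⟨ ⊗-assoc x⁻¹ x y ⟩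
      x⁻¹ ⊗ (x ⊗ y)       ≡⟨ cong (x⁻¹ ⊗_) (trans (⊗-comm x y) yx≡0) ⟩
      x⁻¹ ⊗ ⟦ 0 ⟧         ≡⟨ ⊗-comm x⁻¹ ⟦ 0 ⟧ ⟩
      ⟦ 0 ⟧ ⊗ x⁻¹         ≡⟨ ⊗-zeroˡ x⁻¹ ⟩
      ⟦ 0 ⟧               ∎)

    affine-trans : ∀ {A B C} → AffineEquivalent p A B → AffineEquivalent p B C →
                   AffineEquivalent p A C
    affine-trans (ξ , η , ξ≢0 , B≐ξA+η) (ξ′ , η′ , ξ′≢0 , C≐ξ′B+η′) =
      ξ′ ⊗ ξ , ξ′ ⊗ η ⊕ η′ , ⊗-≢0 ξ≢0 ξ′≢0 ,
      ≐-trans C≐ξ′B+η′ (≐-trans (Image-resp-≐ B≐ξA+η) (≐-trans Image-∘ (Image-cong (affine-∘ ξ η ξ′ η′))))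

    affine-sym : ∀ {A B} → AffineEquivalent p A B → AffineEquivalent p B A
    affine-sym (ξ , η , ξ≢0 , B≐ξA+η) with ⊗-inverse ξ ξ≢0
    ... | ξ⁻¹ , ξ⁻¹ξ≡1 =
      ξ⁻¹ , ⊝ (ξ⁻¹ ⊗ η) , ξ⁻¹≢0 ,
      ≐-trans (≐-sym Image-id)
        (≐-trans (Image-cong (λ x → sym (affine-inverse ξ ξ⁻¹ η x ξ⁻¹ξ≡1)))
          (≐-trans (≐-sym Image-∘) (Image-resp-≐ (≐-sym B≐ξA+η))))
      where
      ξ⁻¹≢0 : ξ⁻¹ ≢ ⟦ 0 ⟧
      ξ⁻¹≢0 ξ⁻¹≡0 = ⟦1⟧≢⟦0⟧ 1<p (trans (sym ξ⁻¹ξ≡1) (trans (cong (_⊗ ξ) ξ⁻¹≡0) (⊗-zeroˡ ξ)))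

lemma3p2 : (p : ℕ) .{{_ : NonZero p}} → Prime p → 7 ≤ p →
    (a : ℕ) → 3 ≤ a → a ≤ p Data.Nat.∸ 3 →
    ¬ AffineEquivalent p (Iset p a) (I'set p a)
    × (∀ A x → PuncturedInterval p a A →
         ¬ AffineEquivalent p A (Interval p a x))
lemma3p2 p p-prime 7≤p a 3≤a a≤p∸3 = I≁I' , λ A x A-punctured A≃J →
  I≁I' (affine-trans (Iset≃Interval 1<p a x)
         (affine-trans (affine-sym A≃J) (affine-sym (punctured⇒≃ 1<p A-punctured))))
  where
  open Residues p
  open Field p-prime
  I≁I' : ¬ AffineEquivalent p (Iset p a) (I'set p a)
  I≁I' = Iset≁I'set 3≤a a≤p∸3 7≤p
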